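{- Let $k$, $p$, $c$ be integers with $k \geq 0$, $p \geq 1$, $c \geq 3$. Let $G=(V,E)$ be a minimum $k$-FT($pK_c$) graph. Then $|E| \leq \left(\binom{c}{2}+ck\right)p + \binom{k}{2}$.
   Context: All graphs are finite, simple and undirected. For integers $k\ge 0$, $p\ge 1$, $c\ge 2$, a graph $G=(V,E)$ is called $k$-FT($pK_c$) if for every $S\subset V$ with $|S|\le k$, the graph $G-S$ contains as a subgraph the disjoint union of $p$ complete graphs $K_c$. $G$ is called minimum $k$-FT($pK_c$) if it is $k$-FT($pK_c$), $|V|=pc+k$, and there is no $k$-FT($pK_c$) graph $G'$ with $|V(G')|=|V|$ and $|E(G')|<|E|$. -}

module Defs where

open import Data.Nat using (ℕ; _+_; _*_; _≤_; _<_)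
open import Data.Fin using (Fin; toℕ)
open import Data.Fin.Subset using (Subset; _∈_; _∉_; ∣_∣)
open import Data.Bool using (Bool; true; false; if_then_else_; _∧_)
open import Data.Nat using (_<ᵇ_)
open import Data.List using (List; map; allFin)
open import Data.Nat.ListAction using (sum)
open import Data.Product using (Σ; _×_)
open import Relation.Binary.PropositionalEquality using (_≡_; _≢_)
open import Relation.Nullary using (¬_)

record Graph (n : ℕ) : Set where
  field
    adj   : Fin n → Fin n → Bool
    sym   : ∀ u v → adj u v ≡ adj v u
    irref : ∀ u → adj u u ≡ false
open Graph public

∣V∣ : ∀ {n} → Graph n → ℕ
∣V∣ {n} _ = n

∣E∣ : ∀ {n} → Graph n → ℕ
∣E∣ {n} G = sum (map (λ u → sum (map (λ v →
  if (toℕ u <ᵇ toℕ v) ∧ adj G u v then 1 else 0) (allFin n))) (allFin n))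

-- G - S contains p disjoint copies of K_c as a subgraph:
-- an injective map  f : Fin p × Fin c → V  avoiding S such that
-- each copy f i (·) is a clique.
ContainsPKcAvoiding : ∀ {n} → (p c : ℕ) → Graph n → Subset n → Set
ContainsPKcAvoiding {n} p c G S =
  Σ (Fin p → Fin c → Fin n) λ f →
    (∀ i a j b → f i a ≡ f j b → (i ≡ j × a ≡ b)) ×
    (∀ i a → f i a ∉ S) ×
    (∀ i a b → a ≢ b → adj G (f i a) (f i b) ≡ true)

IsFT : ∀ {n} → (k p c : ℕ) → Graph n → Set
IsFT {n} k p c G = (S : Subset n) → ∣ S ∣ ≤ k → ContainsPKcAvoiding p c G S

IsMinimumFT : ∀ {n} → (k p c : ℕ) → Graph n → Set
IsMinimumFT {n} k p c G =
  IsFT k p c G × (n ≡ p * c + k) ×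
  (∀ (G' : Graph n) → IsFT k p c G' → ¬ (∣E∣ G' < ∣E∣ G))

-- The bound is witnessed by an explicit k-FT(pK_c) graph on pc + k vertices: p disjoint
-- copies of K_c joined to a clique of k universal vertices. It has p·C(c,2) + k·pc + C(k,2)
-- edges, and a minimum graph has at most that many. Fault tolerance follows by induction
-- on k: if a new universal vertex u survives the deletion of S, apply the hypothesis to S
-- minus one of its vertices s and let u take the place of s in the copies of K_c.
module Submission where

open import Defs
open import Data.Nat using (ℕ; _+_; _*_; _≤_)
open import Data.Nat.Combinatorics using (_C_)

open import Data.Bool using (Bool; true; false; if_then_else_; _∧_)
open import Data.Bool.Properties using (T-≡)
open import Data.Fin using (Fin; toℕ; _↑ˡ_; _↑ʳ_; combine; _≟_) renaming (zero to fzero; suc to fsuc)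
open import Data.Fin.Properties using (toℕ<n; toℕ-↑ˡ; suc-injective; combine-injectiveˡ; combine-injectiveʳ)
open import Data.Fin.Subset using (Subset; _∉_; ∣_∣; _-_; inside; outside)
open import Data.Fin.Subset.Properties using (x∈p⇒∣p-x∣<∣p∣; x∈p∧x≢y⇒x∈p-y; nonempty?; Empty-unique; ∣⊥∣≡0)
open import Data.List using (map; allFin)
open import Data.List.Properties using (map-tabulate; map-cong)
open import Data.Nat using (suc; zero; _<ᵇ_; _<_; z≤n; s≤s)
open import Data.Nat.Combinatorics using (nC1≡n; nCk+nC[k+1]≡[n+1]C[k+1])
open import Data.Nat.ListAction using (sum)
open import Data.Nat.Properties using (≤-refl; ≤-trans; ≤-pred; m≤n⇒m≤1+n; <⇒≱; ≮⇒≥; <⇒<ᵇ; +-mono-≤; +-monoʳ-≤; +-assoc; +-comm; +-identityʳ; module ≤-Reasoning)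
open import Data.Nat.Solver using (module +-*-Solver)
open import Data.Product using (_,_; proj₂)
open import Data.Vec using (_∷_; there)
open import Function using (Equivalence)
open import Relation.Binary.PropositionalEquality as ≡ hiding (sym)
open import Relation.Nullary using (yes; no; contradiction)

sumᶠ : ∀ {m} → (Fin m → ℕ) → ℕ
sumᶠ {m} f = sum (map f (allFin m))

sumᶠ-suc : ∀ {m} (f : Fin (suc m) → ℕ) → sumᶠ f ≡ f fzero + sumᶠ (λ x → f (fsuc x))
sumᶠ-suc f = cong (λ l → f fzero + sum l)
  (trans (map-tabulate fsuc f) (≡.sym (map-tabulate (λ x → x) (λ x → f (fsuc x)))))

sumᶠ-cong : ∀ {m} {f g : Fin m → ℕ} → (∀ x → f x ≡ g x) → sumᶠ f ≡ sumᶠ g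
sumᶠ-cong {m} f≗g = cong sum (map-cong f≗g (allFin m))

count : ∀ {m} → (Fin m → Bool) → ℕ
count w = sumᶠ (λ v → if w v then 1 else 0)

count≤n : ∀ m (w : Fin m → Bool) → count w ≤ m
count≤n zero    w = z≤n
count≤n (suc m) w rewrite sumᶠ-suc (λ v → if w v then 1 else 0) with w fzero
... | true  = s≤s (count≤n m (λ v → w (fsuc v)))
... | false = m≤n⇒m≤1+n (count≤n m (λ v → w (fsuc v)))

count-<ᵇ≤ : ∀ m r → count {m} (λ v → toℕ v <ᵇ r) ≤ r
count-<ᵇ≤ zero    r       = z≤n
count-<ᵇ≤ (suc m) zero    rewrite sumᶠ-suc {m} (λ v → if toℕ v <ᵇ 0 then 1 else 0) =
  count-<ᵇ≤ m zero
count-<ᵇ≤ (suc m) (suc r) rewrite sumᶠ-suc {m} (λ v → if toℕ v <ᵇ suc r then 1 else 0) =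
  s≤s (count-<ᵇ≤ m r)

[1+n]C2≡n+nC2 : ∀ n → suc n C 2 ≡ n + n C 2
[1+n]C2≡n+nC2 n = begin
  suc n C 2      ≡⟨ nCk+nC[k+1]≡[n+1]C[k+1] n 1 ⟨
  n C 1 + n C 2  ≡⟨ cong (_+ n C 2) (nC1≡n n) ⟩
  n + n C 2      ∎
  where open ≡-Reasoning

cone : ∀ {m} → (Fin m → Bool) → Graph m → Graph (suc m)
cone {m} w G = record { adj = A ; sym = A-sym ; irref = A-irref }
  where
  A : Fin (suc m) → Fin (suc m) → Bool
  A fzero    fzero    = false
  A fzero    (fsuc v) = w v
  A (fsuc u) fzero    = w u
  A (fsuc u) (fsuc v) = adj G u v
  A-sym : ∀ u v → A u v ≡ A v u
  A-sym fzero    fzero    = refl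
  A-sym fzero    (fsuc v) = refl
  A-sym (fsuc u) fzero    = refl
  A-sym (fsuc u) (fsuc v) = Graph.sym G u v
  A-irref : ∀ u → A u u ≡ false
  A-irref fzero    = refl
  A-irref (fsuc u) = irref G u

-- Splitting off the vertex fzero leaves the row fzero, which is w, and the column fzero,
-- which vanishes because only pairs u < v are counted; the rest is ∣E∣ G.
∣E∣-cone : ∀ {m} (w : Fin m → Bool) (G : Graph m) → ∣E∣ (cone w G) ≡ count w + ∣E∣ G
∣E∣-cone {m} w G = begin
  ∣E∣ (cone w G)
    ≡⟨ sumᶠ-suc (λ u → sumᶠ (e u)) ⟩
  sumᶠ (e fzero) + sumᶠ (λ u → sumᶠ (e (fsuc u)))
    ≡⟨ cong₂ _+_ (sumᶠ-suc (e fzero)) (sumᶠ-cong (λ u → sumᶠ-suc (e (fsuc u)))) ⟩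
  count w + ∣E∣ G
    ∎
  where
  open ≡-Reasoning
  e : Fin (suc m) → Fin (suc m) → ℕ
  e u v = if (toℕ u <ᵇ toℕ v) ∧ adj (cone w G) u v then 1 else 0

-- K_r ⊎ G, with the clique on the first r vertices.
addClique : ∀ {m} (r : ℕ) → Graph m → Graph (r + m)
addClique zero    G = G
addClique (suc r) G = cone (λ v → toℕ v <ᵇ r) (addClique r G)

∣E∣-addClique : ∀ {m} r (G : Graph m) → ∣E∣ (addClique r G) ≤ r C 2 + ∣E∣ G
∣E∣-addClique zero G = ≤-refl
∣E∣-addClique {m} (suc r) G = begin
  ∣E∣ (addClique (suc r) G)
    ≡⟨ ∣E∣-cone _ (addClique r G) ⟩
  count {r + m} (λ v → toℕ v <ᵇ r) + ∣E∣ (addClique r G)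
    ≤⟨ +-mono-≤ (count-<ᵇ≤ (r + m) r) (∣E∣-addClique r G) ⟩
  r + (r C 2 + ∣E∣ G)
    ≡⟨ +-assoc r (r C 2) (∣E∣ G) ⟨
  (r + r C 2) + ∣E∣ G
    ≡⟨ cong (_+ ∣E∣ G) ([1+n]C2≡n+nC2 r) ⟨
  suc r C 2 + ∣E∣ G
    ∎
  where open ≤-Reasoning

addClique-↑ʳ : ∀ {m} r (G : Graph m) (x y : Fin m) →
  adj (addClique r G) (r ↑ʳ x) (r ↑ʳ y) ≡ adj G x y
addClique-↑ʳ zero    G x y = refl
addClique-↑ʳ (suc r) G x y = addClique-↑ʳ r G x y

addClique-↑ˡ : ∀ {m} r (G : Graph m) (a b : Fin r) → a ≢ b →
  adj (addClique r G) (a ↑ˡ m) (b ↑ˡ m) ≡ true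
addClique-↑ˡ (suc r) G fzero    fzero    a≢b = contradiction refl a≢b
addClique-↑ˡ (suc r) G fzero    (fsuc b) _   = ↑ˡ-<ᵇ r b
  where
  ↑ˡ-<ᵇ : ∀ {m} r (b : Fin r) → (toℕ (b ↑ˡ m) <ᵇ r) ≡ true
  ↑ˡ-<ᵇ {m} r b = Equivalence.to T-≡ (<⇒<ᵇ (subst (_< r) (≡.sym (toℕ-↑ˡ b m)) (toℕ<n b)))
addClique-↑ˡ (suc r) G (fsuc a) fzero    _   = addClique-↑ˡ (suc r) G fzero (fsuc a) (λ ())
addClique-↑ˡ (suc r) G (fsuc a) (fsuc b) a≢b = addClique-↑ˡ r G a b (λ a≡b → a≢b (cong fsuc a≡b))

emptyGraph : Graph 0
emptyGraph = record { adj = λ () ; sym = λ () ; irref = λ () }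

-- p K_c; its i-th copy of K_c sits on the vertices combine i a.
disjointCliques : (p c : ℕ) → Graph (p * c)
disjointCliques zero    c = emptyGraph
disjointCliques (suc p) c = addClique c (disjointCliques p c)

∣E∣-disjointCliques : ∀ p c → ∣E∣ (disjointCliques p c) ≤ p * (c C 2)
∣E∣-disjointCliques zero    c = z≤n
∣E∣-disjointCliques (suc p) c =
  ≤-trans (∣E∣-addClique c (disjointCliques p c)) (+-monoʳ-≤ (c C 2) (∣E∣-disjointCliques p c))

disjointCliques-combine : ∀ p c (i : Fin p) (a b : Fin c) → a ≢ b →
  adj (disjointCliques p c) (combine i a) (combine i b) ≡ true
disjointCliques-combine (suc p) c fzero    a b a≢b = addClique-↑ˡ c (disjointCliques p c) a b a≢b
disjointCliques-combine (suc p) c (fsuc i) a b a≢b =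
  trans (addClique-↑ʳ c (disjointCliques p c) _ _) (disjointCliques-combine p c i a b a≢b)

disjointCliques-FT : ∀ p c → IsFT 0 p c (disjointCliques p c)
disjointCliques-FT p c S ∣S∣≤0 =
  combine ,
  (λ i a j b eq → combine-injectiveˡ i a j b eq , combine-injectiveʳ i a j b eq) ,
  (λ i a x∈S → <⇒≱ (x∈p⇒∣p-x∣<∣p∣ x∈S) (≤-trans ∣S∣≤0 z≤n)) ,
  disjointCliques-combine p c

addUniversal : ∀ {m} → Graph m → Graph (suc m)
addUniversal = cone (λ _ → true)

addUniversals : ∀ {m} (k : ℕ) → Graph m → Graph (k + m)
addUniversals zero    G = G
addUniversals (suc k) G = addUniversal (addUniversals k G)

∣E∣-addUniversals : ∀ {m} k (G : Graph m) → ∣E∣ (addUniversals k G) ≤ k * m + k C 2 + ∣E∣ G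
∣E∣-addUniversals zero G = ≤-refl
∣E∣-addUniversals {m} (suc k) G = begin
  ∣E∣ (addUniversals (suc k) G)
    ≡⟨ ∣E∣-cone _ (addUniversals k G) ⟩
  count {k + m} (λ _ → true) + ∣E∣ (addUniversals k G)
    ≤⟨ +-mono-≤ (count≤n (k + m) _) (∣E∣-addUniversals k G) ⟩
  (k + m) + (k * m + k C 2 + ∣E∣ G)
    ≡⟨ solve 5 (λ k m km kC2 e → (k :+ m) :+ (km :+ kC2 :+ e) := (m :+ km) :+ (k :+ kC2) :+ e)
         refl k m (k * m) (k C 2) (∣E∣ G) ⟩
  (m + k * m) + (k + k C 2) + ∣E∣ G
    ≡⟨ cong (λ x → m + k * m + x + ∣E∣ G) ([1+n]C2≡n+nC2 k) ⟨
  suc k * m + suc k C 2 + ∣E∣ G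
    ∎
  where
  open ≤-Reasoning
  open +-*-Solver

redirect : ∀ {m} → Fin m → Fin m → Fin (suc m)
redirect s x with x ≟ s
... | yes _ = fzero
... | no  _ = fsuc x

redirect-injective : ∀ {m} (s x y : Fin m) → redirect s x ≡ redirect s y → x ≡ y
redirect-injective s x y eq with x ≟ s | y ≟ s
... | yes x≡s | yes y≡s = trans x≡s (≡.sym y≡s)
... | yes _   | no  _   with () ← eq
... | no  _   | yes _   with () ← eq
... | no  _   | no  _   = suc-injective eq

redirect-∉ : ∀ {m} (S : Subset m) (s x : Fin m) → x ∉ S - s → redirect s x ∉ (outside ∷ S)
redirect-∉ S s x x∉S-s with x ≟ s
... | yes _   = λ ()
... | no  x≢s = λ { (there x∈S) → x∉S-s (x∈p∧x≢y⇒x∈p-y x∈S x≢s) }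

redirect-adj : ∀ {m} (G : Graph m) (s x y : Fin m) → x ≢ y → adj G x y ≡ true →
  adj (addUniversal G) (redirect s x) (redirect s y) ≡ true
redirect-adj G s x y x≢y xy with x ≟ s | y ≟ s
... | yes x≡s | yes y≡s = contradiction (trans x≡s (≡.sym y≡s)) x≢y
... | yes _   | no  _   = refl
... | no  _   | yes _   = refl
... | no  _   | no  _   = xy

shift-avoiding : ∀ {m} p c (G : Graph m) (S : Subset m) (b : Bool) →
  ContainsPKcAvoiding p c G S → ContainsPKcAvoiding p c (addUniversal G) (b ∷ S)
shift-avoiding p c G S b (f , f-inj , f∉S , f-clique) =
  (λ i a → fsuc (f i a)) ,
  (λ i a j b eq → f-inj i a j b (suc-injective eq)) ,
  (λ { i a (there x∈S) → f∉S i a x∈S }) ,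
  f-clique

redirect-avoiding : ∀ {m} p c (G : Graph m) (S : Subset m) (s : Fin m) →
  ContainsPKcAvoiding p c G (S - s) → ContainsPKcAvoiding p c (addUniversal G) (outside ∷ S)
redirect-avoiding p c G S s (f , f-inj , f∉S-s , f-clique) =
  (λ i a → redirect s (f i a)) ,
  (λ i a j b eq → f-inj i a j b (redirect-injective s _ _ eq)) ,
  (λ i a → redirect-∉ S s (f i a) (f∉S-s i a)) ,
  (λ i a b a≢b → redirect-adj G s _ _ (λ eq → a≢b (proj₂ (f-inj i a i b eq))) (f-clique i a b a≢b))

addUniversal-FT : ∀ {m} k p c (G : Graph m) → IsFT k p c G → IsFT (suc k) p c (addUniversal G)
addUniversal-FT k p c G ft (inside ∷ S) ∣S∣≤1+k = shift-avoiding p c G S inside (ft S (≤-pred ∣S∣≤1+k))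
addUniversal-FT {m} k p c G ft (outside ∷ S) ∣S∣≤1+k with nonempty? S
... | no  S-empty =
  shift-avoiding p c G S outside (ft S (subst (_≤ k) (≡.sym ∣S∣≡0) z≤n))
  where ∣S∣≡0 = trans (cong ∣_∣ (Empty-unique S-empty)) (∣⊥∣≡0 m)
... | yes (s , s∈S) =
  redirect-avoiding p c G S s (ft (S - s) (≤-pred (≤-trans (x∈p⇒∣p-x∣<∣p∣ s∈S) ∣S∣≤1+k)))

addUniversals-FT : ∀ {m} k j p c (G : Graph m) → IsFT j p c G → IsFT (k + j) p c (addUniversals k G)
addUniversals-FT zero    j p c G ft = ft
addUniversals-FT (suc k) j p c G ft =
  addUniversal-FT (k + j) p c (addUniversals k G) (addUniversals-FT k j p c G ft)

minimumFT-∣E∣-≤ : ∀ {k p c n m} (G : Graph n) → IsMinimumFT k p c G →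
  (H : Graph m) → m ≡ n → IsFT k p c H → ∣E∣ G ≤ ∣E∣ H
minimumFT-∣E∣-≤ G (_ , _ , minimal) H refl H-FT = ≮⇒≥ (minimal H H-FT)

extremalGraph : (k p c : ℕ) → Graph (k + p * c)
extremalGraph k p c = addUniversals k (disjointCliques p c)

extremalGraph-FT : ∀ k p c → IsFT k p c (extremalGraph k p c)
extremalGraph-FT k p c = subst (λ j → IsFT j p c (extremalGraph k p c)) (+-identityʳ k)
  (addUniversals-FT k 0 p c (disjointCliques p c) (disjointCliques-FT p c))

∣E∣-extremalGraph : ∀ k p c → ∣E∣ (extremalGraph k p c) ≤ ((c C 2) + c * k) * p + (k C 2)
∣E∣-extremalGraph k p c = begin
  ∣E∣ (extremalGraph k p c)
    ≤⟨ ∣E∣-addUniversals k (disjointCliques p c) ⟩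
  k * (p * c) + k C 2 + ∣E∣ (disjointCliques p c)
    ≤⟨ +-monoʳ-≤ (k * (p * c) + k C 2) (∣E∣-disjointCliques p c) ⟩
  k * (p * c) + k C 2 + p * (c C 2)
    ≡⟨ solve 5 (λ k p c cC2 kC2 → k :* (p :* c) :+ kC2 :+ p :* cC2 := (cC2 :+ c :* k) :* p :+ kC2)
         refl k p c (c C 2) (k C 2) ⟩
  ((c C 2) + c * k) * p + (k C 2)
    ∎
  where
  open ≤-Reasoning
  open +-*-Solver

lemma8 : (k p c : ℕ) → 1 ≤ p → 3 ≤ c → {n : ℕ} → (G : Graph n) →
    IsMinimumFT k p c G →
    ∣E∣ G ≤ ((c C 2) + c * k) * p + (k C 2)
lemma8 k p c _ _ G G-minimum@(_ , n≡pc+k , _) = ≤-trans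
  (minimumFT-∣E∣-≤ G G-minimum (extremalGraph k p c)
    (trans (+-comm k (p * c)) (≡.sym n≡pc+k)) (extremalGraph-FT k p c))
  (∣E∣-extremalGraph k p c)
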